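{- Let $n\geq1$. For every integer $x$ with $0<x\leq n$, $$xF_{n-x}+F_{n-x+1}\leq F_{n+1},$$ with equality if and only if $x=1$.
   Context: Fibonacci numbers: $F_{ -1}=F_0=1$ and $F_{n+1}=F_n+F_{n-1}$ for $n\geq0$. -}

module Defs where

open import Data.Nat using (ℕ; zero; suc; _+_)

-- Paper's Fibonacci: F_{-1} = F_0 = 1, F_{n+1} = F_n + F_{n-1}.
-- Only nonnegative indices are needed here; F k for k ≥ 0 is  F 0 = 1, F 1 = 2, ...
-- (F 1 = F 0 + F_{-1} = 2).
F : ℕ → ℕ
F zero = 1
F (suc zero) = 2
F (suc (suc k)) = F (suc k) + F k

module Submission where

-- For m = n - x and x = y + 1 the claim reads
--     (y+1)·F m + F (m+1) ≤ F (m+y+2),   with equality iff y = 0.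
-- We prove the stronger inequality with slack y,
--     (y+1)·F m + F (m+1) + y ≤ F (m+y+2),
-- by induction on y: for y = 0 it is the recurrence F (m+2) = F (m+1) + F m,
-- and passing from y to y+1 adds F m + 1 to the left side and F (m+y+1)
-- to the right side, where F m < F (m+y+1) by strict monotonicity of F.
-- Both the inequality and the equality case then follow at once, since a
-- bound  a + y ≤ b  gives  a ≤ b  and forces  y = 0  when  a = b.

open import Defs
open import Data.Nat using (ℕ; zero; suc; _+_; _*_; _∸_; _≤_; _<_; s≤s; z≤n)
open import Data.Nat.Properties
open import Data.Nat.Tactic.RingSolver using (solve-∀)
open import Data.Product using (_×_; _,_)
open import Relation.Binary.PropositionalEquality
open import Function.Bundles using (_⇔_; mk⇔)

F-positive : ∀ k → 1 ≤ F k
F-positive zero          = s≤s z≤n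
F-positive (suc zero)    = s≤s z≤n
F-positive (suc (suc k)) = ≤-trans (F-positive (suc k)) (m≤m+n (F (suc k)) (F k))

F-step : ∀ k → F k < F (suc k)
F-step zero    = s≤s (s≤s z≤n)
F-step (suc k) = begin-strict
  F (suc k)          ≡⟨ +-identityʳ (F (suc k)) ⟨
  F (suc k) + 0      <⟨ +-monoʳ-< (F (suc k)) (F-positive k) ⟩
  F (suc (suc k))    ∎
  where open ≤-Reasoning

F-strictMono : ∀ m y → F m < F (suc (y + m))
F-strictMono m zero    = F-step m
F-strictMono m (suc y) = <-trans (F-strictMono m y) (F-step (suc (y + m)))

F-recurrence : ∀ m → 1 * F m + F (suc m) ≡ F (suc (suc m))
F-recurrence m = commute (F m) (F (suc m))
  where
  commute : ∀ a b → 1 * a + b ≡ b + a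
  commute = solve-∀

F-slackBound : ∀ m y → suc y * F m + F (suc m) + y ≤ F (suc (suc y + m))
F-slackBound m zero = ≤-reflexive (trans (+-identityʳ _) (F-recurrence m))
F-slackBound m (suc y) = begin
  suc (suc y) * F m + F (suc m) + suc y      ≡⟨ regroup (F m) (F (suc m)) y ⟩
  (suc y * F m + F (suc m) + y) + suc (F m)  ≤⟨ +-mono-≤ (F-slackBound m y) (F-strictMono m y) ⟩
  F (suc (suc y + m)) + F (suc y + m)        ∎
  where
  open ≤-Reasoning
  regroup : ∀ a b y → (2 + y) * a + b + (1 + y) ≡ ((1 + y) * a + b + y) + (1 + a)
  regroup = solve-∀

slack-bound : ∀ {a b} y → a + y ≤ b → (a ≤ b) × (a ≡ b → y ≡ 0)
slack-bound {a} y a+y≤b = ≤-trans (m≤m+n a y) a+y≤b , λ { refl → tight a+y≤b }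
  where
  tight : a + y ≤ a → y ≡ 0
  tight a+y≤a = n≤0⇒n≡0 (+-cancelˡ-≤ a y 0 (≤-trans a+y≤a (≤-reflexive (sym (+-identityʳ a)))))

fibonacci-bound : ∀ m y {n} → suc y + m ≡ n →
    (suc y * F m + F (suc m) ≤ F (suc n))
    × ((suc y * F m + F (suc m) ≡ F (suc n)) ⇔ (suc y ≡ 1))
fibonacci-bound m y refl with slack-bound y (F-slackBound m y)
... | bound , tight = bound , mk⇔ (λ eq → cong suc (tight eq)) equality
  where
  equality : suc y ≡ 1 → suc y * F m + F (suc m) ≡ F (suc (suc y + m))
  equality refl = F-recurrence m

lemma5p4 : (n : ℕ) → 1 ≤ n → (x : ℕ) → 0 < x → x ≤ n →
    (x * F (n ∸ x) + F (suc (n ∸ x)) ≤ F (suc n))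
    × ((x * F (n ∸ x) + F (suc (n ∸ x)) ≡ F (suc n)) ⇔ (x ≡ 1))
lemma5p4 n _ (suc y) _ x≤n =
  fibonacci-bound (n ∸ suc y) y (trans (+-comm (suc y) (n ∸ suc y)) (m∸n+n≡m x≤n))
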